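{- Let $G$ be a graph, let $r\ge 1$, and let $w=(v_0,v_1,\dots,v_h)$ be a walk of length $h$ in the graph obtained from $G$ by adding a loop to each vertex (i.e., for each $i$, $v_{i-1}=v_i$ or $v_{i-1}v_i\in E(G)$), such that each vertex of $G$ appears at most $r$ times on $w$. Then $\operatorname{td}(G)\ge\log_{r+1}(h+2)$.
   Context: The treedepth $\operatorname{td}(G)$ is $1$ if $G$ has a single vertex, $1+\min_{v\in V(G)}\operatorname{td}(G-v)$ if $G$ is connected, and otherwise the maximum treedepth of the connected components of $G$. -}

module Defs where

open import Level using (0ℓ)
open import Data.Nat using (ℕ; zero; suc; _≤_)
open import Data.Fin using (Fin; inject₁) renaming (suc to fsuc)
import Data.Fin as Fin
open import Data.Fin.Subset using (Subset; _∈_; _∉_; _⊆_; ∣_∣; ⁅_⁆; ∁; _∩_; Nonempty)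
open import Data.List using (length; filter)
open import Data.List.Base using (allFin)
open import Data.Sum using (_⊎_)
open import Data.Product using (Σ; _×_)
open import Relation.Nullary using (¬_)
open import Relation.Binary.PropositionalEquality using (_≡_)

record Graph (n : ℕ) : Set₁ where
  field
    E     : Fin n → Fin n → Set
    sym   : ∀ {x y} → E x y → E y x
    irrefl : ∀ {x} → ¬ E x x
open Graph public

module _ {n : ℕ} (G : Graph n) where

  data Reach (S : Subset n) (x : Fin n) : Fin n → Set where
    here : x ∈ S → Reach S x x
    step : ∀ {y z} → Reach S x y → z ∈ S → E G y z → Reach S x z

  Connected : Subset n → Set
  Connected S = ∀ {x y} → x ∈ S → y ∈ S → Reach S x y

  -- C is (the vertex set of) a connected component of G[S]:
  -- a nonempty connected subset of S closed under edges within S (i.e. maximal).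
  IsComponent : Subset n → Subset n → Set
  IsComponent S C = C ⊆ S × Nonempty C × Connected C
                    × (∀ {x y} → x ∈ C → y ∈ S → E G x y → y ∈ C)

  _─_ : Subset n → Fin n → Subset n
  S ─ v = S ∩ ∁ ⁅ v ⁆

  -- TD≤ S k : td(G[S]) ≤ k, following the recursive definition of treedepth:
  --  * a single vertex has treedepth 1;
  --  * a connected graph (with ≥ 2 vertices) has td = 1 + min_v td(G - v);
  --  * a disconnected graph has td = max over its components.
  data TD≤ (S : Subset n) : ℕ → Set where
    single : ∀ {k} → ∣ S ∣ ≡ 1 → 1 ≤ k → TD≤ S k
    conn   : ∀ {k} → 2 ≤ ∣ S ∣ → Connected S → (v : Fin n) → v ∈ S
           → TD≤ (S ─ v) k → TD≤ S (suc k)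
    disconn : ∀ {k} → Nonempty S → ¬ Connected S
           → (∀ C → IsComponent S C → TD≤ C k) → TD≤ S k

full : (n : ℕ) → Subset n
full n = Data.Fin.Subset.⊤

LoopWalk : {n : ℕ} → Graph n → (h : ℕ) → (Fin (suc h) → Fin n) → Set
LoopWalk G h w = (i : Fin h) → (w (inject₁ i) ≡ w (fsuc i)) ⊎ E G (w (inject₁ i)) (w (fsuc i))

occ : {n h : ℕ} → (Fin (suc h) → Fin n) → Fin n → ℕ
occ {h = h} w v = length (filter (λ i → w i Fin.≟ v) (allFin (suc h)))

-- Induct on the treedepth derivation, for walks in G[S] that visit each vertex
-- at most r times: if td(G[S]) ≤ k, such a walk (v₀,…,v_h) has h + 2 ≤ (r+1)^k.
-- For a single vertex the walk has at most r entries. If G[S] is connected and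
-- td(G[S] - v) ≤ k - 1, the at most r visits to v cut the walk into at most
-- r + 1 walks in G[S] - v, each with length + 2 at most (r+1)^(k-1), and these
-- quantities add up. If G[S] is disconnected, the walk stays inside the
-- component of its first vertex.
module Submission where

open import Defs
open import Data.Nat using (ℕ; suc; _+_; _^_; _≤_)
open import Data.Fin using (Fin)

open import Level using (Level; 0ℓ)
open import Data.Nat using (zero; _*_; s≤s; _≤?_)
open import Data.Nat.Properties
  using (≤-trans; suc-injective; <-irrefl; m≤m+n; m≤n+m; +-mono-≤; *-monoˡ-≤; ^-monoʳ-≤; m^n>0; *-identityʳ; +-comm; module ≤-Reasoning)
open import Data.Fin using (zero; suc; _≟_)
open import Data.Fin.Subset using (Subset; _∈_; ∣_∣; ⁅_⁆; inside; outside)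
open import Data.Fin.Subset.Properties
  using (∈⊤; x∈p∩q⁺; x∉p⇒x∈∁p; x∈⁅y⁆⇒x≡y; x≢y⇒x∉⁅y⁆; ∣⁅x⁆∣≡1; p⊂q⇒∣p∣<∣q∣)
open import Data.Vec using (_∷_; here; there)
import Data.Vec as Vec
open import Data.List using (List; []; _∷_; _++_; [_]; length; filter; map; tabulate; allFin)
open import Data.List.Properties using (length-++; length-map; length-tabulate; map-tabulate; filter-++; filter-none; filter-all; filter-accept)
open import Data.List.Relation.Unary.All using (All; []; _∷_)
import Data.List.Relation.Unary.All as All
import Data.List.Relation.Unary.All.Properties as All
open import Data.List.Relation.Unary.First using (FirstView) renaming (_++_∷_ to _++[_]_)
open import Data.List.Relation.Unary.Linked using (Linked; []; [-]; _∷_)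
import Data.List.Relation.Unary.Linked as Linked
open import Data.Sum using (_⊎_; inj₁; inj₂)
open import Data.Product using (∃; _×_; _,_; proj₁; proj₂)
open import Data.Bool using (true; false; if_then_else_)
open import Function using (_∘_)
open import Relation.Nullary using (¬_; yes; no; does; contradiction)
open import Relation.Nullary.Decidable using (decidable-stable; ¬¬-excluded-middle)
open import Relation.Unary using (Pred; Decidable)
open import Relation.Binary using (Rel; DecidableEquality)
open import Relation.Binary.PropositionalEquality using (_≡_; _≢_; refl; trans; cong; subst)
import Relation.Binary.PropositionalEquality as ≡

private
  variable
    a ℓ : Level
    A B : Set a
    n : ℕ

¬¬-decidable : (P : Pred (Fin n) ℓ) → ¬ ¬ Decidable P
¬¬-decidable {zero} P ¬P? = ¬P? λ ()
¬¬-decidable {suc n} P ¬P? = ¬¬-excluded-middle λ P0? → ¬¬-decidable (P ∘ suc) λ P? →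
  ¬P? λ { zero → P0? ; (suc i) → P? i }

toSubset : {P : Pred (Fin n) ℓ} → Decidable P → Subset n
toSubset {zero} P? = Vec.[]
toSubset {suc n} P? = (if does (P? zero) then inside else outside) ∷ toSubset (P? ∘ suc)

∈-toSubset⁺ : {P : Pred (Fin n) ℓ} (P? : Decidable P) {x : Fin n} → P x → x ∈ toSubset P?
∈-toSubset⁺ P? {zero} Px with P? zero
... | yes _ = here
... | no ¬Px = contradiction Px ¬Px
∈-toSubset⁺ P? {suc x} Px = there (∈-toSubset⁺ (P? ∘ suc) Px)

∈-toSubset⁻ : {P : Pred (Fin n) ℓ} (P? : Decidable P) {x : Fin n} → x ∈ toSubset P? → P x
∈-toSubset⁻ P? {zero} x∈ with P? zero | x∈
... | yes Px | _ = Px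
... | no _ | ()
∈-toSubset⁻ P? {suc x} (there x∈) = ∈-toSubset⁻ (P? ∘ suc) x∈

∣p∣≡1⇒x≡y : {p : Subset n} {x y : Fin n} → ∣ p ∣ ≡ 1 → x ∈ p → y ∈ p → y ≡ x
∣p∣≡1⇒x≡y {p = p} {x} {y} ∣p∣≡1 x∈p y∈p = decidable-stable (y ≟ x) λ y≢x →
  <-irrefl (trans (∣⁅x⁆∣≡1 x) (≡.sym ∣p∣≡1)) (p⊂q⇒∣p∣<∣q∣ (⁅x⁆⊆p , y , y∈p , x≢y⇒x∉⁅y⁆ y≢x))
  where
  ⁅x⁆⊆p : ∀ {z} → z ∈ ⁅ x ⁆ → z ∈ p
  ⁅x⁆⊆p z∈⁅x⁆ = subst (_∈ p) (≡.sym (x∈⁅y⁆⇒x≡y x z∈⁅x⁆)) x∈p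

filter-map : {P : Pred B ℓ} (P? : Decidable P) (f : A → B) (xs : List A) →
             filter P? (map f xs) ≡ map f (filter (P? ∘ f) xs)
filter-map P? f [] = refl
filter-map P? f (x ∷ xs) with does (P? (f x))
... | true = cong (f x ∷_) (filter-map P? f xs)
... | false = filter-map P? f xs

Linked-++⁻ : {R : Rel A ℓ} (xs : List A) {ys : List A} →
             Linked R (xs ++ ys) → Linked R xs × Linked R ys
Linked-++⁻ [] l = [] , l
Linked-++⁻ (x ∷ []) l = [-] , Linked.tail l
Linked-++⁻ (x ∷ y ∷ xs) (Rxy ∷ l) with Linked-++⁻ (y ∷ xs) l
... | lxs , lys = Rxy ∷ lxs , lys

module Multiplicity (_≟ᴬ_ : DecidableEquality A) where

  count : A → List A → ℕ
  count v xs = length (filter (_≟ᴬ v) xs)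

  Multiplicity≤ : ℕ → List A → Set _
  Multiplicity≤ r xs = ∀ u → count u xs ≤ r

  count-++ : ∀ v xs ys → count v (xs ++ ys) ≡ count v xs + count v ys
  count-++ v xs ys = trans (cong length (filter-++ (_≟ᴬ v) xs ys)) (length-++ (filter (_≟ᴬ v) xs))

  count-all : ∀ {v xs} → All (_≡ v) xs → count v xs ≡ length xs
  count-all {v} xs≡v = cong length (filter-all (_≟ᴬ v) xs≡v)

  count-after-first : ∀ {v pre} → All (_≢ v) pre → ∀ suf → count v (pre ++ v ∷ suf) ≡ suc (count v suf)
  count-after-first {v} {pre} pre≢v suf = begin
    count v (pre ++ v ∷ suf)        ≡⟨ count-++ v pre (v ∷ suf) ⟩
    count v pre + count v (v ∷ suf) ≡⟨ cong (_+ count v (v ∷ suf)) (cong length (filter-none (_≟ᴬ v) pre≢v)) ⟩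
    count v (v ∷ suf)               ≡⟨ cong length (filter-accept (_≟ᴬ v) refl) ⟩
    suc (count v suf)               ∎
    where open ≡.≡-Reasoning

  Multiplicity≤-++⁻ : ∀ {r} xs {ys} → Multiplicity≤ r (xs ++ ys) → Multiplicity≤ r xs × Multiplicity≤ r ys
  Multiplicity≤-++⁻ xs {ys} m =
    (λ u → ≤-trans (m≤m+n _ _) (subst (_≤ _) (count-++ u xs ys) (m u))) ,
    (λ u → ≤-trans (m≤n+m _ _) (subst (_≤ _) (count-++ u xs ys) (m u)))

  split-at-first : ∀ v xs → All (_≢ v) xs ⊎ FirstView (_≢ v) (_≡ v) xs
  split-at-first v [] = inj₁ []
  split-at-first v (x ∷ xs) with x ≟ᴬ v | split-at-first v xs
  ... | yes x≡v | _ = inj₂ ([] ++[ x≡v ] xs)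
  ... | no x≢v | inj₁ xs≢v = inj₁ (x≢v ∷ xs≢v)
  ... | no x≢v | inj₂ (pre≢v ++[ y≡v ] suf) = inj₂ ((x≢v ∷ pre≢v) ++[ y≡v ] suf)

  -- Cutting xs at the occurrences of v leaves count v xs + 1 pieces avoiding v.
  module _ {q} (Q : Pred (List A) q) (Q-++⁻ : ∀ xs {ys} → Q (xs ++ ys) → Q xs × Q ys)
           (v : A) (T : ℕ) (Q-avoiding : ∀ {xs} → Q xs → All (_≢ v) xs → suc (length xs) ≤ T) where

    private
      bound-by-count : ∀ N xs → count v xs ≡ N → Q xs → suc (length xs) ≤ suc N * T
      bound-by-count N xs _ Qxs with split-at-first v xs
      ... | inj₁ xs≢v = ≤-trans (Q-avoiding Qxs xs≢v) (m≤m+n T (N * T))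
      bound-by-count zero _ count≡0 _ | inj₂ (pre≢v ++[ refl ] suf) =
        contradiction (trans (≡.sym (count-after-first pre≢v suf)) count≡0) λ ()
      bound-by-count (suc N) _ count≡N Qxs | inj₂ (_++[_]_ {pre} pre≢v refl suf) =
        subst (_≤ suc (suc N) * T) (cong suc (≡.sym (length-++ pre)))
          (+-mono-≤ (Q-avoiding Qpre pre≢v) (bound-by-count N suf count-suf≡N Qsuf))
        where
        count-suf≡N : count v suf ≡ N
        count-suf≡N = suc-injective (trans (≡.sym (count-after-first pre≢v suf)) count≡N)
        Qpre : Q pre
        Qpre = proj₁ (Q-++⁻ pre Qxs)
        Qsuf : Q suf
        Qsuf = proj₂ (Q-++⁻ [ v ] (proj₂ (Q-++⁻ pre Qxs)))

    pieces-bound : ∀ {xs} → Q xs → suc (length xs) ≤ suc (count v xs) * T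
    pieces-bound Qxs = bound-by-count _ _ refl Qxs

module FinMultiplicity {n : ℕ} = Multiplicity (_≟_ {n})
open FinMultiplicity

module _ {n : ℕ} (G : Graph n) where

  Adj : Rel (Fin n) 0ℓ
  Adj x y = x ≡ y ⊎ E G x y

  IsWalkIn : Subset n → List (Fin n) → Set
  IsWalkIn S xs = Linked Adj xs × All (_∈ S) xs

  IsWalkIn-++⁻ : ∀ {S} xs {ys} → IsWalkIn S (xs ++ ys) → IsWalkIn S xs × IsWalkIn S ys
  IsWalkIn-++⁻ xs (linked , xs++ys⊆S) with Linked-++⁻ xs linked | All.++⁻ xs xs++ys⊆S
  ... | lxs , lys | xs⊆S , ys⊆S = (lxs , xs⊆S) , (lys , ys⊆S)

  Reach-∈ : ∀ {S x y} → Reach G S x y → y ∈ S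
  Reach-∈ (here x∈S) = x∈S
  Reach-∈ (step _ z∈S _) = z∈S

  Reach-trans : ∀ {S x y z} → Reach G S x y → Reach G S y z → Reach G S x z
  Reach-trans p (here _) = p
  Reach-trans p (step q z∈S e) = step (Reach-trans p q) z∈S e

  Reach-sym : ∀ {S x y} → Reach G S x y → Reach G S y x
  Reach-sym (here x∈S) = here x∈S
  Reach-sym (step q z∈S e) = Reach-trans (step (here z∈S) (Reach-∈ q) (Graph.sym G e)) (Reach-sym q)

  Reach-restrict : ∀ {S C x} → (∀ {y} → Reach G S x y → y ∈ C) → ∀ {y} → Reach G S x y → Reach G C x y
  Reach-restrict ⊆C p@(here _) = here (⊆C p)
  Reach-restrict ⊆C p@(step q _ e) = step (Reach-restrict ⊆C q) (⊆C p) e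

  walk-reachable : ∀ {S x y xs} → Reach G S x y → IsWalkIn S (y ∷ xs) → All (Reach G S x) (y ∷ xs)
  walk-reachable p ([-] , _) = p ∷ []
  walk-reachable p (inj₁ refl ∷ linked , _ ∷ zs⊆S) = p ∷ walk-reachable p (linked , zs⊆S)
  walk-reachable p (inj₂ e ∷ linked , _ ∷ zs⊆S@(z∈S ∷ _)) = p ∷ walk-reachable (step p z∈S e) (linked , zs⊆S)

  -- The component is the set of vertices reachable from x, which is a subset
  -- only classically since E is not assumed decidable.
  component-containing : ∀ {S x} → x ∈ S →
    ¬ ¬ ∃ λ C → IsComponent G S C × (∀ {y} → Reach G S x y → y ∈ C)
  component-containing {S} {x} x∈S ¬C = ¬¬-decidable (Reach G S x) λ reach? →
    let C = toSubset reach?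
        reach⊆C : ∀ {y} → Reach G S x y → y ∈ C
        reach⊆C = ∈-toSubset⁺ reach?
        C⊆reach : ∀ {y} → y ∈ C → Reach G C x y
        C⊆reach = Reach-restrict reach⊆C ∘ ∈-toSubset⁻ reach?
    in ¬C (C , ( Reach-∈ ∘ ∈-toSubset⁻ reach?
               , (x , reach⊆C (here x∈S))
               , (λ y∈C z∈C → Reach-trans (Reach-sym (C⊆reach y∈C)) (C⊆reach z∈C))
               , (λ y∈C z∈S e → reach⊆C (step (∈-toSubset⁻ reach? y∈C) z∈S e)))
          , reach⊆C)

  avoiding-vertex : ∀ {S v xs} → All (_∈ S) xs → All (_≢ v) xs → All (_∈ _─_ G S v) xs
  avoiding-vertex xs⊆S xs≢v = All.zipWith (λ (x∈S , x≢v) → x∈p∩q⁺ (x∈S , x∉p⇒x∈∁p (x≢y⇒x∉⁅y⁆ x≢v))) (xs⊆S , xs≢v)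

  walk-bound : ∀ r {S k xs} → TD≤ G S k → IsWalkIn S xs → Multiplicity≤ r xs → suc (length xs) ≤ suc r ^ k
  walk-bound r {k = k} {[]} _ _ _ = m^n>0 (suc r) k
  walk-bound r {k = k} {x ∷ xs} (single ∣S∣≡1 1≤k) (_ , x∈S ∷ xs⊆S) mult = begin
    suc (length (x ∷ xs))   ≡⟨ cong suc (≡.sym (count-all (All.map (∣p∣≡1⇒x≡y ∣S∣≡1 x∈S) (x∈S ∷ xs⊆S)))) ⟩
    suc (count x (x ∷ xs))  ≤⟨ s≤s (mult x) ⟩
    suc r                   ≡⟨ ≡.sym (*-identityʳ (suc r)) ⟩
    suc r ^ 1               ≤⟨ ^-monoʳ-≤ (suc r) 1≤k ⟩
    suc r ^ k               ∎
    where open ≤-Reasoning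
  walk-bound r {S} {xs = xs} (conn {k} _ _ v _ td) walk mult = begin
    suc (length xs)              ≤⟨ pieces-bound Q Q-++⁻ v (suc r ^ k) avoiding (walk , mult) ⟩
    suc (count v xs) * suc r ^ k ≤⟨ *-monoˡ-≤ (suc r ^ k) (s≤s (mult v)) ⟩
    suc r * suc r ^ k            ∎
    where
    open ≤-Reasoning
    Q : List (Fin n) → Set
    Q ys = IsWalkIn S ys × Multiplicity≤ r ys
    Q-++⁻ : ∀ ys {zs} → Q (ys ++ zs) → Q ys × Q zs
    Q-++⁻ ys (walk , mult) with IsWalkIn-++⁻ ys walk | Multiplicity≤-++⁻ ys mult
    ... | wys , wzs | mys , mzs = (wys , mys) , (wzs , mzs)
    avoiding : ∀ {ys} → Q ys → All (_≢ v) ys → suc (length ys) ≤ suc r ^ k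
    avoiding ((linked , ys⊆S) , mult) ys≢v = walk-bound r td (linked , avoiding-vertex ys⊆S ys≢v) mult
  walk-bound r {xs = x ∷ xs} (disconn _ _ td) walk@(linked , x∈S ∷ _) mult =
    decidable-stable (_ ≤? _) λ ≰ → component-containing x∈S λ (C , C-component , reach⊆C) →
      ≰ (walk-bound r (td C C-component) (linked , All.map reach⊆C (walk-reachable (here x∈S) walk)) mult)

walk-linked : ∀ {n h} (G : Graph n) {w : Fin (suc h) → Fin n} → LoopWalk G h w → Linked (Adj G) (tabulate w)
walk-linked {h = zero} G _ = [-]
walk-linked {h = suc h} G {w} steps = steps zero ∷ walk-linked G {w ∘ suc} (steps ∘ suc)

occ≡count : ∀ {n h} (w : Fin (suc h) → Fin n) u → occ w u ≡ count u (tabulate w)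
occ≡count {h = h} w u = begin
  length (filter (λ i → w i ≟ u) is)         ≡⟨ ≡.sym (length-map w (filter (λ i → w i ≟ u) is)) ⟩
  length (map w (filter (λ i → w i ≟ u) is)) ≡⟨ cong length (≡.sym (filter-map (_≟ u) w is)) ⟩
  length (filter (_≟ u) (map w is))          ≡⟨ cong (length ∘ filter (_≟ u)) (map-tabulate (λ i → i) w) ⟩
  count u (tabulate w)                       ∎
  where
  open ≡.≡-Reasoning
  is : List (Fin (suc h))
  is = allFin (suc h)

lemma5 : {n : ℕ} (G : Graph n) (r h : ℕ) → 1 ≤ r → (w : Fin (suc h) → Fin n)
    → LoopWalk G h w → (∀ v → occ w v ≤ r)
    → ∀ k → TD≤ G (full n) k → h + 2 ≤ (r + 1) ^ k
lemma5 {n} G r h _ w steps occ≤r k td = begin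
  h + 2                     ≡⟨ +-comm h 2 ⟩
  suc (suc h)               ≡⟨ cong suc (≡.sym (length-tabulate w)) ⟩
  suc (length (tabulate w)) ≤⟨ walk-bound G r td walk (λ u → subst (_≤ r) (occ≡count w u) (occ≤r u)) ⟩
  suc r ^ k                 ≡⟨ cong (_^ k) (+-comm 1 r) ⟩
  (r + 1) ^ k               ∎
  where
  open ≤-Reasoning
  walk : IsWalkIn G (full n) (tabulate w)
  walk = walk-linked G {w} steps , All.tabulate⁺ {f = w} (λ _ → ∈⊤)
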